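{- Let $S$ be a positive semifield and $(X,a,b)$ a $\delta$-algebra. For every $A\subseteq X$, $\bigsqcup^b_{x\in A}x=\bigsqcup^b_{x\in\mathrm{conv}_a(A)}x$, where $\bigsqcup^b_{x\in B}x:=b(B)$.
   Context: $S$ positive: $a+b=0\Rightarrow a=b=0$; semifield: nonzero elements invertible. $\mathcal S$: monad on Set with $\mathcal SX$ the finitely supported $X\to S$, $\mathcal S(f)(\phi)(y)=\sum_{x\in f^{ -1}\{y\}}\phi(x)$, unit Dirac functions, $\mu(\Psi)(x)=\sum_\phi\Psi(\phi)\phi(x)$. $\mathcal P$: powerset monad. For $\Phi\in\mathcal S\mathcal PX$, with $\ni_X=\{(A,x)\mid x\in A\}$: $\delta_X(\Phi)=\{\phi\in\mathcal SX\mid\exists\psi\in\mathcal S(\ni_X).\ \forall A.\ \Phi(A)=\sum_{x\in A}\psi(A,x),\ \forall x.\ \phi(x)=\sum_{A\ni x}\psi(A,x)\}$. A $\delta$-algebra is a set $X$ with an $\mathcal S$-algebra structure $a\colon\mathcal SX\to X$ and a $\mathcal P$-algebra structure $b\colon\mathcal PX\to X$ such that $a\circ\mathcal S(b)=b\circ\mathcal P(a)\circ\delta_X$. For $A\subseteq X$, $\mathrm{conv}_a(A)=\{a(\phi)\mid\mathrm{supp}\,\phi\subseteq A,\ \sum\phi(x)=1\}$. -}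

module Defs where

open import Level using (Level; _⊔_; Setω) renaming (suc to lsuc)
open import Data.List using (List; []; _∷_; map; foldr; concatMap)
open import Data.List.Relation.Unary.All using (All)
open import Data.Product using (Σ; ∃; _×_; _,_; proj₁; proj₂)
open import Data.Sum using (_⊎_)
open import Relation.Binary.PropositionalEquality using (_≡_; _≢_)
open import Algebra.Structures using (IsCommutativeSemiring)
open import Relation.Unary using (Pred)

record PositiveSemifield : Set₁ where
  infixl 6 _+_
  infixl 7 _*_
  field
    Carrier : Set
    _+_ _*_ : Carrier → Carrier → Carrier
    0# 1# : Carrier
    isCommutativeSemiring : IsCommutativeSemiring _≡_ _+_ _*_ 0# 1#
    invertible : ∀ x → x ≢ 0# → ∃ λ y → x * y ≡ 1#
    positive : ∀ x y → x + y ≡ 0# → (x ≡ 0#) × (y ≡ 0#)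

SameSubset : ∀ {x ℓ ℓ'} {X : Set x} → Pred X ℓ → Pred X ℓ' → Set (x ⊔ ℓ ⊔ ℓ')
SameSubset {X = X} A B = ∀ (y : X) → (A y → B y) × (B y → A y)

module _ (S : PositiveSemifield) where
  open PositiveSemifield S

  -- Representatives (formal finite sums Σ sᵢ·kᵢ) of elements of 𝒮K.
  FS : ∀ {k} → Set k → Set k
  FS K = List (K × Carrier)

  -- Two formal sums represent the same finitely supported function K/R → S.
  -- (R is the equality of the underlying set K.)
  data FSEq {k r} {K : Set k} (R : K → K → Set r) : FS K → FS K → Set (k ⊔ r) where
    fs-refl  : ∀ {L} → FSEq R L L
    fs-sym   : ∀ {L L'} → FSEq R L L' → FSEq R L' L
    fs-trans : ∀ {L L' L''} → FSEq R L L' → FSEq R L' L'' → FSEq R L L''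
    fs-cons  : ∀ {e L L'} → FSEq R L L' → FSEq R (e ∷ L) (e ∷ L')
    fs-swap  : ∀ {e e' L} → FSEq R (e ∷ e' ∷ L) (e' ∷ e ∷ L)
    fs-key   : ∀ {x y s L} → R x y → FSEq R ((x , s) ∷ L) ((y , s) ∷ L)
    fs-merge : ∀ {x s t L} → FSEq R ((x , s) ∷ (x , t) ∷ L) ((x , s + t) ∷ L)
    fs-zero  : ∀ {x L} → FSEq R ((x , 0#) ∷ L) L

  mapKeys : ∀ {k k'} {K : Set k} {K' : Set k'} → (K → K') → FS K → FS K'
  mapKeys f = map (λ e → (f (proj₁ e) , proj₂ e))

  η : ∀ {k} {K : Set k} → K → FS K
  η x = (x , 1#) ∷ []

  scale : ∀ {k} {K : Set k} → Carrier → FS K → FS K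
  scale s = map (λ e → (proj₁ e , s * proj₂ e))

  μ : ∀ {k} {K : Set k} → FS (FS K) → FS K
  μ = concatMap (λ e → scale (proj₂ e) (proj₁ e))

  total : ∀ {k} {K : Set k} → FS K → Carrier
  total = foldr (λ e acc → proj₂ e + acc) 0#

  Mem : (X : Set) (ℓ : Level) → Set (lsuc ℓ)
  Mem X ℓ = Σ (Pred X ℓ) (λ A → Σ X A)

  -- δ_X(Φ) = {φ | ∃ψ ∈ 𝒮(∋_X). Φ(A) = Σ_{x∈A} ψ(A,x), φ(x) = Σ_{A∋x} ψ(A,x)}
  δ : ∀ {X : Set} {ℓ} → FS (Pred X ℓ) → Pred (FS X) (lsuc ℓ)
  δ {X} {ℓ} Φ φ = ∃ λ (ψ : FS (Mem X ℓ)) →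
      FSEq SameSubset (mapKeys proj₁ ψ) Φ
    × FSEq _≡_ (mapKeys (λ m → proj₁ (proj₂ m)) ψ) φ

  -- δ-algebra: 𝒮-algebra a, 𝒫-algebra b (subsets of X = predicates of any
  -- level, up to extensional equality), and a ∘ 𝒮(b) = b ∘ 𝒫(a) ∘ δ_X.
  record DeltaAlgebra (X : Set) : Setω where
    field
      a      : FS X → X
      a-resp : ∀ {L L'} → FSEq _≡_ L L' → a L ≡ a L'
      a-unit : ∀ (x : X) → a (η x) ≡ x
      a-mult : ∀ (Ψ : FS (FS X)) → a (μ Ψ) ≡ a (mapKeys a Ψ)
      b      : ∀ {ℓ} → Pred X ℓ → X
      b-resp : ∀ {ℓ ℓ'} {A : Pred X ℓ} {B : Pred X ℓ'} → SameSubset A B → b A ≡ b B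
      b-unit : ∀ (x : X) → b (λ y → y ≡ x) ≡ x
      b-mult : ∀ {ℓ ℓ'} (𝔄 : Pred (Pred X ℓ) ℓ') →
               b (λ x → ∃ λ A → 𝔄 A × A x) ≡ b (λ y → ∃ λ A → 𝔄 A × b A ≡ y)
      law    : ∀ {ℓ} (Φ : FS (Pred X ℓ)) →
               a (mapKeys b Φ) ≡ b (λ y → ∃ λ φ → δ Φ φ × a φ ≡ y)

  -- conv_a(A) = {a(φ) | supp φ ⊆ A, Σ φ(x) = 1}; "supp φ ⊆ A" on a
  -- representative: every entry has key in A or weight 0.
  conv : ∀ {X : Set} {ℓ} → (FS X → X) → Pred X ℓ → Pred X ℓ
  conv a A y = ∃ λ L → All (λ e → A (proj₁ e) ⊎ proj₂ e ≡ 0#) L × total L ≡ 1# × a L ≡ y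

  ⨆ : ∀ {X : Set} {ℓ} → DeltaAlgebra X → Pred X ℓ → X
  ⨆ D B = DeltaAlgebra.b D B

{-# OPTIONS --safe #-}
module Submission where

-- Since a ∘ η = id, b(A) = a(η (b A)), and the δ-law rewrites this as b applied to
-- { a φ | φ ∈ δ(η A) }.  For a positive S, δ(η A) consists exactly of the
-- distributions supported in A: a coupling ψ between η A and φ only pairs points
-- of A with A, and conversely every distribution on A is the second marginal of
-- the coupling that pairs each of its points with A.

open import Defs
open import Level using (Level; Lift; lift)
open import Relation.Unary using (Pred)
open import Relation.Binary.PropositionalEquality
  using (_≡_; refl; sym; trans; cong; cong₂; subst; module ≡-Reasoning)
open import Data.List using ([]; _∷_)
open import Data.List.Relation.Unary.All as All using (All; []; _∷_)
open import Data.List.Relation.Unary.All.Properties using (map⁺; map⁻)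
open import Data.Product using (∃; Σ; _×_; _,_; proj₁; proj₂)
open import Data.Sum using (_⊎_; inj₁; inj₂)
open import Algebra.Structures using (IsCommutativeSemiring)

SameSubset-refl : ∀ {x ℓ} {X : Set x} (A : Pred X ℓ) → SameSubset A A
SameSubset-refl A y = (λ p → p) , (λ p → p)

SameSubset-sym : ∀ {x ℓ ℓ'} {X : Set x} {A : Pred X ℓ} {B : Pred X ℓ'} →
                 SameSubset A B → SameSubset B A
SameSubset-sym A≐B y = proj₂ (A≐B y) , proj₁ (A≐B y)

SameSubset-trans : ∀ {x ℓ ℓ' ℓ''} {X : Set x} {A : Pred X ℓ} {B : Pred X ℓ'} {C : Pred X ℓ''} →
                   SameSubset A B → SameSubset B C → SameSubset A C
SameSubset-trans A≐B B≐C y = (λ p → proj₁ (B≐C y) (proj₁ (A≐B y) p))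
                           , (λ p → proj₂ (A≐B y) (proj₂ (B≐C y) p))

module _ (S : PositiveSemifield) where
  open PositiveSemifield S
  open IsCommutativeSemiring isCommutativeSemiring
    using (+-assoc; +-comm; +-identityˡ; +-identityʳ)

  SupportedIn : ∀ {k p} {K : Set k} → Pred K p → Pred (FS S K) _
  SupportedIn P = All (λ e → P (proj₁ e) ⊎ proj₂ e ≡ 0#)

  total-resp : ∀ {k r} {K : Set k} {R : K → K → Set r} {L L'} →
               FSEq S R L L' → total S L ≡ total S L'
  total-resp fs-refl = refl
  total-resp (fs-sym e) = sym (total-resp e)
  total-resp (fs-trans e f) = trans (total-resp e) (total-resp f)
  total-resp {L = (_ , s) ∷ _} (fs-cons e) = cong (s +_) (total-resp e)
  total-resp {L = (_ , s) ∷ (_ , t) ∷ L} fs-swap = begin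
    s + (t + total S L)   ≡⟨ sym (+-assoc s t _) ⟩
    (s + t) + total S L   ≡⟨ cong (_+ total S L) (+-comm s t) ⟩
    (t + s) + total S L   ≡⟨ +-assoc t s _ ⟩
    t + (s + total S L)   ∎
    where open ≡-Reasoning
  total-resp (fs-key _) = refl
  total-resp {L = (_ , s) ∷ (_ , t) ∷ L} fs-merge = sym (+-assoc s t _)
  total-resp fs-zero = +-identityˡ _

  total-mapKeys : ∀ {k k'} {K : Set k} {K' : Set k'} (f : K → K') (L : FS S K) →
                  total S (mapKeys S f L) ≡ total S L
  total-mapKeys f [] = refl
  total-mapKeys f ((_ , s) ∷ L) = cong (s +_) (total-mapKeys f L)

  -- fs-merge is the one step needing positivity: s + t = 0 forces s = t = 0.
  supportedIn-resp : ∀ {k r p} {K : Set k} {R : K → K → Set r} {P : Pred K p} →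
                     (∀ {x y} → R x y → (P x → P y) × (P y → P x)) →
                     ∀ {L L'} → FSEq S R L L' →
                     (SupportedIn P L → SupportedIn P L') × (SupportedIn P L' → SupportedIn P L)
  supportedIn-resp P-resp fs-refl = (λ h → h) , (λ h → h)
  supportedIn-resp P-resp (fs-sym e) = proj₂ (supportedIn-resp P-resp e) , proj₁ (supportedIn-resp P-resp e)
  supportedIn-resp P-resp (fs-trans e f) =
      (λ h → proj₁ (supportedIn-resp P-resp f) (proj₁ (supportedIn-resp P-resp e) h))
    , (λ h → proj₂ (supportedIn-resp P-resp e) (proj₂ (supportedIn-resp P-resp f) h))
  supportedIn-resp P-resp (fs-cons e) =
      (λ { (h ∷ hs) → h ∷ proj₁ (supportedIn-resp P-resp e) hs })
    , (λ { (h ∷ hs) → h ∷ proj₂ (supportedIn-resp P-resp e) hs })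
  supportedIn-resp P-resp fs-swap =
    (λ { (h ∷ h' ∷ hs) → h' ∷ h ∷ hs }) , (λ { (h ∷ h' ∷ hs) → h' ∷ h ∷ hs })
  supportedIn-resp P-resp (fs-key r) =
      (λ { (inj₁ p ∷ hs) → inj₁ (proj₁ (P-resp r) p) ∷ hs ; (inj₂ z ∷ hs) → inj₂ z ∷ hs })
    , (λ { (inj₁ p ∷ hs) → inj₁ (proj₂ (P-resp r) p) ∷ hs ; (inj₂ z ∷ hs) → inj₂ z ∷ hs })
  supportedIn-resp P-resp {(_ , s) ∷ (_ , t) ∷ _} fs-merge = merged , unmerged
    where
    merged : ∀ {x L} → SupportedIn _ ((x , s) ∷ (x , t) ∷ L) → SupportedIn _ ((x , s + t) ∷ L)
    merged (inj₁ p ∷ _ ∷ hs) = inj₁ p ∷ hs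
    merged (inj₂ _ ∷ inj₁ p ∷ hs) = inj₁ p ∷ hs
    merged (inj₂ s≡0 ∷ inj₂ t≡0 ∷ hs) = inj₂ (trans (cong₂ _+_ s≡0 t≡0) (+-identityˡ 0#)) ∷ hs
    unmerged : ∀ {x L} → SupportedIn _ ((x , s + t) ∷ L) → SupportedIn _ ((x , s) ∷ (x , t) ∷ L)
    unmerged (inj₁ p ∷ hs) = inj₁ p ∷ inj₁ p ∷ hs
    unmerged (inj₂ s+t≡0 ∷ hs) = inj₂ (proj₁ (positive s t s+t≡0)) ∷ inj₂ (proj₂ (positive s t s+t≡0)) ∷ hs
  supportedIn-resp P-resp fs-zero = (λ { (_ ∷ hs) → hs }) , (λ hs → inj₂ refl ∷ hs)

  module _ {X : Set} {ℓ : Level} where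

    point : Mem S X ℓ → X
    point m = proj₁ (proj₂ m)

    supportedIn-points : ∀ {p} {A : Pred X p} (ψ : FS S (Mem S X ℓ)) →
                         SupportedIn (SameSubset A) (mapKeys S proj₁ ψ) →
                         SupportedIn A (mapKeys S point ψ)
    supportedIn-points {A = A} ψ h = map⁺ (All.map (λ {e} → inPoint {e}) (map⁻ h))
      where
      inPoint : ∀ {e : Mem S X ℓ × Carrier} →
                SameSubset A (proj₁ (proj₁ e)) ⊎ proj₂ e ≡ 0# → A (point (proj₁ e)) ⊎ proj₂ e ≡ 0#
      inPoint {(B , x , x∈B) , _} (inj₁ A≐B) = inj₁ (proj₂ (A≐B x) x∈B)
      inPoint (inj₂ z) = inj₂ z

    -- A zero-weight point outside A is paired with the singleton of itself.
    couplingTo : (A : Pred X ℓ) (L : FS S X) → SupportedIn A L →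
                 Σ (FS S (Mem S X ℓ)) λ ψ →
                   mapKeys S point ψ ≡ L × FSEq S SameSubset (mapKeys S proj₁ ψ) ((A , total S L) ∷ [])
    couplingTo A [] [] = [] , refl , fs-sym fs-zero
    couplingTo A ((x , s) ∷ L) (inj₁ x∈A ∷ hs) with couplingTo A L hs
    ... | ψ , points , sets =
      ((A , x , x∈A) , s) ∷ ψ , cong ((x , s) ∷_) points , fs-trans (fs-cons sets) fs-merge
    couplingTo A ((x , s) ∷ L) (inj₂ refl ∷ hs) with couplingTo A L hs
    ... | ψ , points , sets =
        ((((λ w → Lift ℓ (w ≡ x)) , x , lift refl)) , 0#) ∷ ψ
      , cong ((x , 0#) ∷_) points
      , fs-trans fs-zero (subst (λ u → FSEq S SameSubset _ ((A , u) ∷ [])) (sym (+-identityˡ _)) sets)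

    δ-η⇒supported : ∀ (A : Pred X ℓ) {φ} → δ S (η S A) φ →
                    ∃ λ L → SupportedIn A L × total S L ≡ 1# × FSEq S _≡_ L φ
    δ-η⇒supported A (ψ , sets , points) =
        mapKeys S point ψ
      , supportedIn-points ψ (proj₂ (supportedIn-resp equalsA-resp sets) (inj₁ (SameSubset-refl A) ∷ []))
      , (begin
          total S (mapKeys S point ψ)      ≡⟨ total-mapKeys point ψ ⟩
          total S ψ                        ≡⟨ sym (total-mapKeys proj₁ ψ) ⟩
          total S (mapKeys S proj₁ ψ)      ≡⟨ total-resp sets ⟩
          1# + 0#                          ≡⟨ +-identityʳ 1# ⟩
          1#                               ∎)
      , points
      where
      open ≡-Reasoning
      equalsA-resp : ∀ {B C : Pred X ℓ} → SameSubset B C →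
                     (SameSubset A B → SameSubset A C) × (SameSubset A C → SameSubset A B)
      equalsA-resp B≐C = (λ A≐B → SameSubset-trans A≐B B≐C)
                       , (λ A≐C → SameSubset-trans A≐C (SameSubset-sym B≐C))

    supported⇒δ-η : ∀ (A : Pred X ℓ) {L} → SupportedIn A L → total S L ≡ 1# → δ S (η S A) L
    supported⇒δ-η A {L} hs total≡1 with couplingTo A L hs
    ... | ψ , points , sets =
        ψ
      , subst (λ u → FSEq S SameSubset (mapKeys S proj₁ ψ) ((A , u) ∷ [])) total≡1 sets
      , subst (FSEq S _≡_ (mapKeys S point ψ)) points fs-refl

proposition5p8 : (S : PositiveSemifield) {X : Set} (D : DeltaAlgebra S X) {ℓ : Level} (A : Pred X ℓ) →
    ⨆ S D A ≡ ⨆ S D (conv S (DeltaAlgebra.a D) A)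
proposition5p8 S D A = begin
  b A                                               ≡⟨ sym (a-unit (b A)) ⟩
  a (η S (b A))                                     ≡⟨ law (η S A) ⟩
  b (λ y → ∃ λ φ → δ S (η S A) φ × a φ ≡ y)         ≡⟨ b-resp (λ y → image⊆conv y , conv⊆image y) ⟩
  b (conv S a A)                                    ∎
  where
  open ≡-Reasoning
  open DeltaAlgebra D
  image⊆conv : ∀ y → (∃ λ φ → δ S (η S A) φ × a φ ≡ y) → conv S a A y
  image⊆conv y (φ , φ∈δ , aφ≡y) with δ-η⇒supported S A φ∈δ
  ... | L , hs , total≡1 , L≈φ = L , hs , total≡1 , trans (a-resp L≈φ) aφ≡y
  conv⊆image : ∀ y → conv S a A y → ∃ λ φ → δ S (η S A) φ × a φ ≡ y
  conv⊆image y (L , hs , total≡1 , aL≡y) = L , supported⇒δ-η S A hs total≡1 , aL≡y
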